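{- Let $n \geq 8$ be even and $k \geq 3$ be an integer with $2k<n$ and $\gcd(n,k)=1$. Then $$6 \leq \sigma^{ - }(P(n,k)) \leq n.$$
   Context: For $n \geq 3$, $k \geq 1$ with $2k<n$, the generalized Petersen graph $P(n,k)$ has vertex set $\{u_i, v_i : i=0,1,\dots,n-1\}$ and edge set $\{u_iu_{i+1},\ u_iv_i,\ v_iv_{i+k} : i=0,\dots,n-1\}$, subscripts read modulo $n$. For a simple connected graph $G$ of order $N$, the \textbf{rna} number $\sigma^{ - }(G)$ is the minimum, over all bijections $f: V(G)\to\{1,2,\dots,N\}$, of the number of edges $uv$ of $G$ such that $f(u)$ and $f(v)$ have different parity. -}

module Defs where

open import Data.Nat using (ℕ; suc; _+_; _*_; _%_; NonZero)
open import Data.Nat.Properties using ()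
open import Data.Fin using (Fin; toℕ; fromℕ<)
open import Data.Nat.DivMod using (m%n<n)
open import Data.Product using (_×_; _,_; Σ; ∃)
open import Data.Bool using (Bool; true; false)
open import Data.List using (List; []; _∷_; _++_; length; filter; concatMap; allFin)
open import Relation.Nullary using (¬_)
open import Relation.Nullary.Decidable using (Dec; yes; no; ¬?)
open import Data.Nat using (_≟_)
open import Relation.Binary.PropositionalEquality using (_≡_)
open import Function.Bundles using (_⤖_; Bijection)

-- Vertices of P(n,k): (false , i) is u_i, (true , i) is v_i.
PVertex : ℕ → Set
PVertex n = Bool × Fin n

_+ₘ_ : ∀ {n} .{{_ : NonZero n}} → Fin n → ℕ → Fin n
_+ₘ_ {n} i j = fromℕ< (m%n<n (toℕ i + j) n)

-- Edge list of P(n,k): for each i, u_i u_{i+1}, u_i v_i, v_i v_{i+k}.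
-- (When 2k < n these 3n edges are pairwise distinct, so this list is
-- exactly the edge set.)
PEdges : (n k : ℕ) .{{_ : NonZero n}} → List (PVertex n × PVertex n)
PEdges n k = concatMap
  (λ i → ((false , i) , (false , (i +ₘ 1)))
       ∷ ((false , i) , (true , i))
       ∷ ((true , i) , (true , (i +ₘ k)))
       ∷ [])
  (allFin n)

-- A labeling f : V → Fin N stands for the label toℕ (f x) + 1 ∈ {1..N};
-- parity of toℕ (f x) + 1 differs iff parity of toℕ (f x) differs.
parity : ∀ {N} → Fin N → ℕ
parity a = toℕ a % 2

oddEdges : ∀ {V : Set} {N : ℕ} → (V → Fin N) → List (V × V) → ℕ
oddEdges f es = length (filter (λ e → ¬? (parity (f (Data.Product.proj₁ e)) ≟ parity (f (Data.Product.proj₂ e)))) es)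

Labeling : (n : ℕ) → Set
Labeling n = PVertex n ⤖ Fin (2 * n)

rnaCount : (n k : ℕ) .{{_ : NonZero n}} → Labeling n → ℕ
rnaCount n k f = oddEdges (Bijection.to f) (PEdges n k)

-- σ⁻(P(n,k)) ≥ m  : every bijective labeling has at least m odd edges
-- σ⁻(P(n,k)) ≤ m  : some bijective labeling has at most m odd edges
-- (σ⁻ is the minimum of rnaCount over the finite nonempty set of labelings.)
σ⁻≥ : (n k : ℕ) .{{_ : NonZero n}} → ℕ → Set
σ⁻≥ n k m = ∀ (f : Labeling n) → m Data.Nat.≤ rnaCount n k f

σ⁻≤ : (n k : ℕ) .{{_ : NonZero n}} → ℕ → Set
σ⁻≤ n k m = Σ (Labeling n) λ f → rnaCount n k f Data.Nat.≤ m

module Submission where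

-- A labeling is recorded by the parity patterns p and q of the outer and the inner cycle, p i and q i telling
-- whether u_i and v_i get odd labels; since exactly n labels are odd, p and q have n ones together. The odd
-- edges are the C₁ places where p changes between i and i + 1, the D spokes where p and q differ, and the Cₖ
-- places where q changes between i and i + k. All three numbers are even: a cyclic sequence has as many
-- ascents as descents, and D ≡ |p| + |q| = n mod 2. If C₁ = 0 then p is constant and D = n; if Cₖ = 0 then
-- q has periods n and k, hence is constant as gcd(n, k) = 1, and again D = n. Otherwise each of C₁, D, Cₖ
-- is at least 2 unless D = 0, that is p = q with n/2 ones; then either C₁ ≥ 4, or C₁ = 2 and the ones of p
-- form a single block of length n/2, which the shift by 2 ≤ k < n/2 moves off itself in at least two
-- places, so that Cₖ ≥ 4. Conversely, giving every u_i an odd and every v_i an even label makes exactly the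
-- n spokes odd.

open import Defs
open import Data.Nat using (ℕ; suc; _*_; _<_; _≤_; NonZero)
open import Data.Nat.GCD using (gcd)
open import Data.Nat.Divisibility using (_∣_)
open import Data.Product using (_×_)
open import Relation.Binary.PropositionalEquality using (_≡_)

open import Data.Nat using (zero; _+_; _∸_; z≤n; s≤s; z<s; s<s; _≟_; _≡ᵇ_; ≢-nonZero)
open import Data.Nat.Properties
open import Data.Nat.DivMod using (_%_; _/_; m%n<n; m≡m%n+[m/n]*n; m<n⇒m%n≡m; [m+n]%n≡m%n; %-remove-+ˡ)
open import Data.Nat.Divisibility using (divides; ∣m+n∣m⇒∣n; m∣m*n; ∣⇒≤)
open import Data.Nat.GCD using (GCD; gcd-GCD; module Bézout)
open import Data.Bool using (Bool; true; false; not; _∧_; _xor_)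
open import Data.Bool.Properties using (xor-comm; xor-same)
open import Data.Fin using (Fin; toℕ; zero; suc; fromℕ<; cast; combine)
open import Data.Fin.Properties
  using (toℕ-injective; toℕ-fromℕ<; toℕ<n; fromℕ<-cong; 2↔Bool; *↔×; toℕ-cast; cast-involutive; toℕ-combine)
open import Data.List using (List; []; _∷_; _++_; length; filter; concat; concatMap; tabulate; allFin)
open import Data.List.Properties using (filter-++; length-++; map-tabulate)
open import Level using (0ℓ)
open import Relation.Unary using (Pred; Decidable)
open import Relation.Nullary.Decidable using (does; ¬?)
open import Data.Product using (_,_; proj₁; proj₂; ∃-syntax)
open import Data.Sum using (_⊎_; inj₁; inj₂)
open import Function using (_∘_; id)
open import Function.Bundles using (Bijection; Inverse; _↔_; mk↔ₛ′)
open import Function.Construct.Composition using (_↔-∘_)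
open import Function.Construct.Identity using (↔-id)
open import Function.Construct.Symmetry using (↔-sym)
open import Function.Properties.Bijection using (⤖⇒↔)
open import Function.Properties.Inverse using (↔⇒⤖)
open import Data.Product.Algebra using (×-comm; ×-cong)
open import Relation.Nullary using (¬_; Dec; yes; no; contradiction)
open import Relation.Binary.PropositionalEquality
  using (_≢_; refl; sym; trans; cong; cong₂; subst; module ≡-Reasoning)
open import Data.Nat.Tactic.RingSolver using (solve-∀)
open import Algebra.Properties.CommutativeMonoid.Sum +-0-commutativeMonoid
  using (sum; sum-cong-≗; ∑-distrib-+; sum-permute)

open Bézout using (Identity; +-; -+)

+-rightComm : ∀ m n o → m + n + o ≡ m + o + n
+-rightComm = solve-∀

m+m≡m*2 : ∀ m → m + m ≡ m * 2
m+m≡m*2 = solve-∀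

-- Sums over initial segments of ℕ

sumBelow : ℕ → (ℕ → ℕ) → ℕ
sumBelow N f = sum {N} (f ∘ toℕ)

sumBelow-cong : ∀ N {f g : ℕ → ℕ} → (∀ j → j < N → f j ≡ g j) → sumBelow N f ≡ sumBelow N g
sumBelow-cong zero    f≡g = refl
sumBelow-cong (suc N) f≡g = cong₂ _+_ (f≡g 0 z<s) (sumBelow-cong N (λ j j<N → f≡g (suc j) (s<s j<N)))

sumBelow-+ : ∀ N (f g : ℕ → ℕ) → sumBelow N (λ j → f j + g j) ≡ sumBelow N f + sumBelow N g
sumBelow-+ N f g = ∑-distrib-+ {N} (f ∘ toℕ) (g ∘ toℕ)

sumBelow-const : ∀ N {f : ℕ → ℕ} {c} → (∀ j → j < N → f j ≡ c) → sumBelow N f ≡ N * c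
sumBelow-const zero    f≡c = refl
sumBelow-const (suc N) f≡c = cong₂ _+_ (f≡c 0 z<s) (sumBelow-const N (λ j j<N → f≡c (suc j) (s<s j<N)))

sumBelow-split : ∀ M N (f : ℕ → ℕ) → sumBelow (M + N) f ≡ sumBelow M f + sumBelow N (λ j → f (M + j))
sumBelow-split zero    N f = refl
sumBelow-split (suc M) N f = trans (cong (f 0 +_) (sumBelow-split M N (f ∘ suc))) (sym (+-assoc (f 0) _ _))

sumBelow-snoc : ∀ N (f : ℕ → ℕ) → sumBelow (suc N) f ≡ sumBelow N f + f N
sumBelow-snoc N f = begin
  sumBelow (suc N) f               ≡⟨ cong (λ M → sumBelow M f) (+-comm 1 N) ⟩
  sumBelow (N + 1) f               ≡⟨ sumBelow-split N 1 f ⟩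
  sumBelow N f + (f (N + 0) + 0)   ≡⟨ cong (λ x → sumBelow N f + x) (trans (+-identityʳ _) (cong f (+-identityʳ N))) ⟩
  sumBelow N f + f N               ∎
  where open ≡-Reasoning

sumBelow-≡0 : ∀ N (f : ℕ → ℕ) → sumBelow N f ≡ 0 → ∀ j → j < N → f j ≡ 0
sumBelow-≡0 (suc N) f Σ≡0 zero    _         = m+n≡0⇒m≡0 (f 0) Σ≡0
sumBelow-≡0 (suc N) f Σ≡0 (suc j) (s<s j<N) = sumBelow-≡0 N (f ∘ suc) (m+n≡0⇒n≡0 (f 0) Σ≡0) j j<N

sumBelow-positive : ∀ N (f : ℕ → ℕ) → 0 < sumBelow N f → ∃[ j ] j < N × 0 < f j
sumBelow-positive (suc N) f Σ>0 with f 0 in f0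
... | suc _ = 0 , z<s , subst (0 <_) (sym f0) z<s
... | zero with sumBelow-positive N (f ∘ suc) Σ>0
...   | j , j<N , fj>0 = suc j , s<s j<N , fj>0

sumBelow-prefix : ∀ {M N} (f : ℕ → ℕ) → M ≤ N → sumBelow M f ≤ sumBelow N f
sumBelow-prefix {M} {N} f M≤N with m≤n⇒∃[o]m+o≡n M≤N
... | o , refl = subst (sumBelow M f ≤_) (sym (sumBelow-split M o f)) (m≤m+n _ _)

Periodic : ∀ {A : Set} → ℕ → (ℕ → A) → Set
Periodic N a = ∀ j → a (j + N) ≡ a j

sumBelow-rotate : ∀ N (f : ℕ → ℕ) → Periodic N f → ∀ s → sumBelow N (λ j → f (j + s)) ≡ sumBelow N f
sumBelow-rotate N f per zero    = sumBelow-cong N (λ j _ → cong f (+-identityʳ j))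
sumBelow-rotate N f per (suc s) = begin
  sumBelow N (λ j → f (j + suc s))     ≡⟨ sumBelow-cong N (λ j _ → cong f (+-suc j s)) ⟩
  sumBelow N (g ∘ suc)                 ≡⟨ +-cancelˡ-≡ (g 0) _ _ shift ⟩
  sumBelow N g                         ≡⟨ sumBelow-rotate N f per s ⟩
  sumBelow N f                         ∎
  where
  open ≡-Reasoning
  g : ℕ → ℕ
  g j = f (j + s)
  shift : g 0 + sumBelow N (g ∘ suc) ≡ g 0 + sumBelow N g
  shift = begin
    sumBelow (suc N) g    ≡⟨ sumBelow-snoc N g ⟩
    sumBelow N g + g N    ≡⟨ cong (sumBelow N g +_) (trans (cong f (+-comm N s)) (per s)) ⟩
    sumBelow N g + g 0    ≡⟨ +-comm _ (g 0) ⟩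
    g 0 + sumBelow N g    ∎

-- Cyclic 0/1 sequences

bit : Bool → ℕ
bit false = 0
bit true  = 1

weight : ℕ → (ℕ → Bool) → ℕ
weight N a = sumBelow N (bit ∘ a)

distance : ℕ → (ℕ → Bool) → (ℕ → Bool) → ℕ
distance N a b = sumBelow N (λ j → bit (a j xor b j))

changes : ℕ → ℕ → (ℕ → Bool) → ℕ
changes N s a = distance N a (λ j → a (j + s))

descents : ℕ → ℕ → (ℕ → Bool) → ℕ
descents N s a = sumBelow N (λ j → bit (a j ∧ not (a (j + s))))

bit-xor : ∀ x y → bit (x xor y) ≡ bit (x ∧ not y) + bit (not x ∧ y)
bit-xor false false = refl
bit-xor false true  = refl
bit-xor true  false = refl
bit-xor true  true  = refl

bit-splitˡ : ∀ x y → bit x ≡ bit (x ∧ y) + bit (x ∧ not y)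
bit-splitˡ false y     = refl
bit-splitˡ true  false = refl
bit-splitˡ true  true  = refl

bit-splitʳ : ∀ x y → bit y ≡ bit (x ∧ y) + bit (not x ∧ y)
bit-splitʳ false y     = refl
bit-splitʳ true  false = refl
bit-splitʳ true  true  = refl

bit-xor+∧+∧ : ∀ x y → bit (x xor y) + bit (x ∧ y) + bit (x ∧ y) ≡ bit x + bit y
bit-xor+∧+∧ false false = refl
bit-xor+∧+∧ false true  = refl
bit-xor+∧+∧ true  false = refl
bit-xor+∧+∧ true  true  = refl

bit-not+bit : ∀ x → bit (not x) + bit x ≡ 1
bit-not+bit false = refl
bit-not+bit true  = refl

bit-xor-triangle : ∀ x y z → bit (x xor z) ≤ bit (x xor y) + bit (y xor z)
bit-xor-triangle false false z     = ≤-refl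
bit-xor-triangle false true  false = z≤n
bit-xor-triangle false true  true  = s≤s z≤n
bit-xor-triangle true  false false = s≤s z≤n
bit-xor-triangle true  false true  = z≤n
bit-xor-triangle true  true  z     = ≤-refl

bit-xor≡0 : ∀ {x y} → bit (x xor y) ≡ 0 → x ≡ y
bit-xor≡0 {false} {false} _ = refl
bit-xor≡0 {true}  {true}  _ = refl

not-xor-not : ∀ x y → not x xor not y ≡ x xor y
not-xor-not false false = refl
not-xor-not false true  = refl
not-xor-not true  false = refl
not-xor-not true  true  = refl

changes≡descents+descents : ∀ N s a → Periodic N a → changes N s a ≡ descents N s a + descents N s a
changes≡descents+descents N s a per = begin
  changes N s a       ≡⟨ sumBelow-cong N (λ j _ → bit-xor (a j) (a (j + s))) ⟩
  sumBelow N (λ j → Dj j + Uj j)  ≡⟨ sumBelow-+ N Dj Uj ⟩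
  D + U               ≡⟨ cong (D +_) (sym D≡U) ⟩
  D + D               ∎
  where
  open ≡-Reasoning
  Dj Uj Bj : ℕ → ℕ
  Dj j = bit (a j ∧ not (a (j + s)))
  Uj j = bit (not (a j) ∧ a (j + s))
  Bj j = bit (a j ∧ a (j + s))
  D U : ℕ
  D = descents N s a
  U = sumBelow N Uj
  D≡U : D ≡ U
  D≡U = +-cancelˡ-≡ (sumBelow N Bj) _ _ (begin
    sumBelow N Bj + D                      ≡⟨ sumBelow-+ N Bj Dj ⟨
    sumBelow N (λ j → Bj j + Dj j)         ≡⟨ sumBelow-cong N (λ j _ → bit-splitˡ (a j) (a (j + s))) ⟨
    weight N a                             ≡⟨ sumBelow-rotate N (bit ∘ a) (cong bit ∘ per) s ⟨
    sumBelow N (λ j → bit (a (j + s)))     ≡⟨ sumBelow-cong N (λ j _ → bit-splitʳ (a j) (a (j + s))) ⟩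
    sumBelow N (λ j → Bj j + Uj j)         ≡⟨ sumBelow-+ N Bj Uj ⟩
    sumBelow N Bj + U                      ∎)

changes-even : ∀ N s a → Periodic N a → 2 ∣ changes N s a
changes-even N s a per = divides (descents N s a)
  (trans (changes≡descents+descents N s a per) (m+m≡m*2 (descents N s a)))

distance-even : ∀ N m a b → weight N a + weight N b ≡ m + m → 2 ∣ distance N a b
distance-even N m a b wa+wb≡m+m = ∣m+n∣m⇒∣n 2∣O+O+d (divides O (m+m≡m*2 O))
  where
  O : ℕ
  O = sumBelow N (λ j → bit (a j ∧ b j))
  d+O+O : distance N a b + O + O ≡ weight N a + weight N b
  d+O+O = begin
    distance N a b + O + O
      ≡⟨ cong (_+ O) (sumBelow-+ N (λ j → bit (a j xor b j)) (λ j → bit (a j ∧ b j))) ⟨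
    sumBelow N (λ j → bit (a j xor b j) + bit (a j ∧ b j)) + O
      ≡⟨ sumBelow-+ N (λ j → bit (a j xor b j) + bit (a j ∧ b j)) (λ j → bit (a j ∧ b j)) ⟨
    sumBelow N (λ j → bit (a j xor b j) + bit (a j ∧ b j) + bit (a j ∧ b j))
      ≡⟨ sumBelow-cong N (λ j _ → bit-xor+∧+∧ (a j) (b j)) ⟩
    sumBelow N (λ j → bit (a j) + bit (b j))
      ≡⟨ sumBelow-+ N (bit ∘ a) (bit ∘ b) ⟩
    weight N a + weight N b ∎
    where open ≡-Reasoning
  2∣O+O+d : 2 ∣ O + O + distance N a b
  2∣O+O+d = divides m (begin
    O + O + distance N a b   ≡⟨ +-comm (O + O) _ ⟩
    distance N a b + (O + O) ≡⟨ +-assoc (distance N a b) O O ⟨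
    distance N a b + O + O   ≡⟨ d+O+O ⟩
    weight N a + weight N b  ≡⟨ wa+wb≡m+m ⟩
    m + m                    ≡⟨ m+m≡m*2 m ⟩
    m * 2                    ∎)
    where open ≡-Reasoning

distance-comm : ∀ N a b → distance N a b ≡ distance N b a
distance-comm N a b = sumBelow-cong N (λ j _ → cong bit (xor-comm (a j) (b j)))

weight-rotate : ∀ N a → Periodic N a → ∀ r → weight N (λ j → a (j + r)) ≡ weight N a
weight-rotate N a per = sumBelow-rotate N (bit ∘ a) (cong bit ∘ per)

changes-rotate : ∀ N s a → Periodic N a → ∀ r → changes N s (λ j → a (j + r)) ≡ changes N s a
changes-rotate N s a per r = begin
  changes N s (λ j → a (j + r))  ≡⟨ sumBelow-cong N (λ j _ → cong (λ i → bit (a (j + r) xor a i)) (+-rightComm j s r)) ⟩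
  sumBelow N (λ j → f (j + r))   ≡⟨ sumBelow-rotate N f f-periodic r ⟩
  changes N s a                  ∎
  where
  open ≡-Reasoning
  f : ℕ → ℕ
  f j = bit (a j xor a (j + s))
  f-periodic : Periodic N f
  f-periodic j = cong₂ (λ x y → bit (x xor y)) (per j) (trans (cong a (+-rightComm j N s)) (per (j + s)))

weight-not+weight : ∀ N a → weight N (not ∘ a) + weight N a ≡ N
weight-not+weight N a = begin
  weight N (not ∘ a) + weight N a         ≡⟨ sumBelow-+ N (bit ∘ not ∘ a) (bit ∘ a) ⟨
  sumBelow N (λ j → bit (not (a j)) + bit (a j)) ≡⟨ sumBelow-const N (λ j _ → bit-not+bit (a j)) ⟩
  N * 1                                   ≡⟨ *-identityʳ N ⟩
  N                                       ∎
  where open ≡-Reasoning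

changes-not : ∀ N s a → changes N s (not ∘ a) ≡ changes N s a
changes-not N s a = sumBelow-cong N (λ j _ → cong bit (not-xor-not (a j) (a (j + s))))

periodic-* : ∀ {A : Set} s (a : ℕ → A) → Periodic s a → ∀ j t → a (j + t * s) ≡ a j
periodic-* s a per j zero    = cong a (+-identityʳ j)
periodic-* s a per j (suc t) = begin
  a (j + (s + t * s))  ≡⟨ cong a (trans (+-rightComm j (t * s) s) (+-assoc j s (t * s))) ⟨
  a (j + t * s + s)    ≡⟨ per (j + t * s) ⟩
  a (j + t * s)        ≡⟨ periodic-* s a per j t ⟩
  a j                  ∎
  where open ≡-Reasoning

periodic-mod : ∀ {A : Set} N .{{_ : NonZero N}} (a : ℕ → A) → Periodic N a → ∀ j → a j ≡ a (j % N)
periodic-mod N a per j = trans (cong a (m≡m%n+[m/n]*n j N)) (periodic-* N a per (j % N) (j / N))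

periodic-ext : ∀ {A : Set} N .{{_ : NonZero N}} (a b : ℕ → A) → Periodic N a → Periodic N b →
               (∀ j → j < N → a j ≡ b j) → ∀ j → a j ≡ b j
periodic-ext N a b perᵃ perᵇ a≡b j =
  trans (periodic-mod N a perᵃ j) (trans (a≡b (j % N) (m%n<n j N)) (sym (periodic-mod N b perᵇ j)))

changes≡0⇒periodic : ∀ N .{{_ : NonZero N}} s a → Periodic N a → changes N s a ≡ 0 → Periodic s a
changes≡0⇒periodic N s a per Σ≡0 j = sym (periodic-ext N a (λ i → a (i + s)) per per-shifted agree j)
  where
  per-shifted : Periodic N (λ i → a (i + s))
  per-shifted i = trans (cong a (+-rightComm i N s)) (per (i + s))
  agree : ∀ i → i < N → a i ≡ a (i + s)
  agree i i<N = bit-xor≡0 (sumBelow-≡0 N _ Σ≡0 i i<N)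

-- Bézout: some combination of the two periods differs by exactly one step.
coprime-periods⇒constant : ∀ {A : Set} N s (a : ℕ → A) → Periodic N a → Periodic s a →
                           Identity 1 N s → ∀ j → a j ≡ a 0
coprime-periods⇒constant N s a perᴺ perˢ bézout zero    = refl
coprime-periods⇒constant N s a perᴺ perˢ bézout (suc j) =
  trans (unit-step bézout) (coprime-periods⇒constant N s a perᴺ perˢ bézout j)
  where
  open ≡-Reasoning
  unit-step : Identity 1 N s → a (suc j) ≡ a j
  unit-step (+- x y 1+ys≡xN) = begin
    a (suc j)               ≡⟨ periodic-* s a perˢ (suc j) y ⟨
    a (suc j + y * s)       ≡⟨ cong a (+-suc j (y * s)) ⟨
    a (j + (1 + y * s))     ≡⟨ cong (λ i → a (j + i)) 1+ys≡xN ⟩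
    a (j + x * N)           ≡⟨ periodic-* N a perᴺ j x ⟩
    a j                     ∎
  unit-step (-+ x y 1+xN≡ys) = begin
    a (suc j)               ≡⟨ periodic-* N a perᴺ (suc j) x ⟨
    a (suc j + x * N)       ≡⟨ cong a (+-suc j (x * N)) ⟨
    a (j + (1 + x * N))     ≡⟨ cong (λ i → a (j + i)) 1+xN≡ys ⟩
    a (j + y * s)           ≡⟨ periodic-* s a perˢ j y ⟩
    a j                     ∎

distance-const : ∀ N a b c → (∀ j → j < N → a j ≡ c) → weight N a + weight N b ≡ N → distance N a b ≡ N
distance-const N a b false a≡false wa+wb≡N = begin
  distance N a b        ≡⟨ sumBelow-cong N (λ j j<N → cong (λ x → bit (x xor b j)) (a≡false j j<N)) ⟩
  weight N b            ≡⟨ cong (_+ weight N b) wa≡0 ⟨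
  weight N a + weight N b ≡⟨ wa+wb≡N ⟩
  N                     ∎
  where
  open ≡-Reasoning
  wa≡0 : weight N a ≡ 0
  wa≡0 = trans (sumBelow-const N (λ j j<N → cong bit (a≡false j j<N))) (*-zeroʳ N)
distance-const N a b true a≡true wa+wb≡N = begin
  distance N a b        ≡⟨ sumBelow-cong N (λ j j<N → cong (λ x → bit (x xor b j)) (a≡true j j<N)) ⟩
  weight N (not ∘ b)    ≡⟨ +-identityʳ _ ⟨
  weight N (not ∘ b) + 0 ≡⟨ cong (weight N (not ∘ b) +_) wb≡0 ⟨
  weight N (not ∘ b) + weight N b ≡⟨ weight-not+weight N b ⟩
  N                     ∎
  where
  open ≡-Reasoning
  wa≡N : weight N a ≡ N
  wa≡N = trans (sumBelow-const N (λ j j<N → cong bit (a≡true j j<N))) (*-identityʳ N)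
  wb≡0 : weight N b ≡ 0
  wb≡0 = +-cancelˡ-≡ N _ 0 (trans (cong (_+ weight N b) (sym wa≡N)) (trans wa+wb≡N (sym (+-identityʳ N))))

-- A block of ones

xor-path : ∀ (a : ℕ → Bool) x d → bit (a x xor a (x + d)) ≤ sumBelow d (λ t → bit (a (x + t) xor a (x + t + 1)))
xor-path a x zero    = ≤-reflexive (cong bit (trans (cong (λ i → a x xor a i) (+-identityʳ x)) (xor-same (a x))))
xor-path a x (suc d) = begin
  bit (a x xor a (x + suc d))
    ≤⟨ bit-xor-triangle (a x) (a (x + d)) (a (x + suc d)) ⟩
  bit (a x xor a (x + d)) + bit (a (x + d) xor a (x + suc d))
    ≡⟨ cong (λ i → bit (a x xor a (x + d)) + bit (a (x + d) xor a i)) x+d+1≡x+suc-d ⟨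
  bit (a x xor a (x + d)) + δ d
    ≤⟨ +-monoˡ-≤ (δ d) (xor-path a x d) ⟩
  sumBelow d δ + δ d
    ≡⟨ sumBelow-snoc d δ ⟨
  sumBelow (suc d) δ ∎
  where
  open ≤-Reasoning
  δ : ℕ → ℕ
  δ t = bit (a (x + t) xor a (x + t + 1))
  x+d+1≡x+suc-d : x + d + 1 ≡ x + suc d
  x+d+1≡x+suc-d = trans (+-assoc x d 1) (cong (x +_) (+-comm d 1))

single-ascent-monotone : ∀ (a : ℕ → Bool) L → a 0 ≡ false → sumBelow L (λ t → bit (a t xor a (t + 1))) ≤ 1 →
                         ∀ i d → i + d ≤ L → a i ≡ true → a (i + d) ≡ true
single-ascent-monotone a L a0≡false Σ≤1 i d i+d≤L ai≡true =
  trans (sym (bit-xor≡0 (n≤0⇒n≡0 (+-cancelˡ-≤ 1 _ 0 (begin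
    1 + bit (a i xor a (i + d))                ≡⟨ cong (λ x → bit (false xor x) + bit (a i xor a (i + d))) ai≡true ⟨
    bit (false xor a i) + bit (a i xor a (i + d)) ≡⟨ cong (λ x → bit (x xor a i) + bit (a i xor a (i + d))) a0≡false ⟨
    bit (a 0 xor a i) + bit (a i xor a (i + d)) ≤⟨ +-mono-≤ (xor-path a 0 i) (xor-path a i d) ⟩
    sumBelow i δ + sumBelow d (λ t → δ (i + t)) ≡⟨ sumBelow-split i d δ ⟨
    sumBelow (i + d) δ                           ≤⟨ sumBelow-prefix δ i+d≤L ⟩
    sumBelow L δ                                 ≤⟨ Σ≤1 ⟩
    1                                            ∎))))) ai≡true
  where
  open ≤-Reasoning
  δ : ℕ → ℕ
  δ t = bit (a t xor a (t + 1))

-- The two changes force a to be false on [0, m) and true on [m, 2 + M); the shift by k = 2 + k′ < m then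
-- carries the last two positions, M and 1 + M, to the false positions k′ and 1 + k′.
module NormalisedBlock
  (M k′ m : ℕ) (a : ℕ → Bool) (per : Periodic (2 + M) a) (N≡m+m : 2 + M ≡ m + m) (k<m : 2 + k′ < m)
  (weight≡m : weight (2 + M) a ≡ m) (two-changes : changes (2 + M) 1 a ≡ 2)
  (a0≡false : a 0 ≡ false) (aL≡true : a (suc M) ≡ true)
  where

  open ≤-Reasoning

  δ : ℕ → ℕ
  δ t = bit (a t xor a (t + 1))

  one-ascent : sumBelow (suc M) δ ≤ 1
  one-ascent = ≤-reflexive (+-cancelʳ-≡ 1 _ 1 (begin-equality
    sumBelow (suc M) δ + 1           ≡⟨ cong (λ x → sumBelow (suc M) δ + bit (true xor x)) aN≡false ⟨
    sumBelow (suc M) δ + bit (true xor a (suc M + 1)) ≡⟨ cong (λ x → sumBelow (suc M) δ + bit (x xor a (suc M + 1))) aL≡true ⟨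
    sumBelow (suc M) δ + δ (suc M)   ≡⟨ sumBelow-snoc (suc M) δ ⟨
    changes (2 + M) 1 a              ≡⟨ two-changes ⟩
    2                                ∎))
    where
    aN≡false : a (suc M + 1) ≡ false
    aN≡false = trans (cong a (+-comm (suc M) 1)) (trans (per 0) a0≡false)

  monotone : ∀ i d → i + d ≤ suc M → a i ≡ true → a (i + d) ≡ true
  monotone = single-ascent-monotone a (suc M) a0≡false one-ascent

  3≤m : 3 ≤ m
  3≤m = ≤-trans (s≤s (s≤s (s≤s z≤n))) k<m

  1+k′<m : suc k′ < m
  1+k′<m = <⇒≤ k<m

  m≤L : m ≤ suc M
  m≤L = ≤-pred (begin
    suc m   ≡⟨ +-comm 1 m ⟩
    m + 1   ≤⟨ +-monoʳ-≤ m (≤-trans (s≤s z≤n) 3≤m) ⟩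
    m + m   ≡⟨ N≡m+m ⟨
    2 + M   ∎)

  aM≡true : a M ≡ true
  aM≡true with a M in aM
  ... | true  = refl
  ... | false = contradiction (begin-equality
    m                                      ≡⟨ weight≡m ⟨
    weight (2 + M) a                       ≡⟨ sumBelow-snoc (suc M) (bit ∘ a) ⟩
    weight (suc M) a + bit (a (suc M))     ≡⟨ cong (_+ bit (a (suc M))) (sumBelow-snoc M (bit ∘ a)) ⟩
    weight M a + bit (a M) + bit (a (suc M)) ≡⟨ cong₂ (λ x y → x + bit (a M) + bit y) prefix≡0 aL≡true ⟩
    0 + bit (a M) + 1                      ≡⟨ cong (λ x → bit x + 1) aM ⟩
    1                                      ∎) (<⇒≢ (≤-trans (s≤s (s≤s z≤n)) 3≤m) ∘ sym)
    where
    below-false : ∀ j → j < M → bit (a j) ≡ 0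
    below-false j j<M with a j in aj
    ... | false = refl
    ... | true  = contradiction
      (trans (sym aM) (trans (cong a (sym (m+[n∸m]≡n j≤M))) (monotone j (M ∸ j) j+[M∸j]≤L aj))) λ ()
      where
      j≤M : j ≤ M
      j≤M = <⇒≤ j<M
      j+[M∸j]≤L : j + (M ∸ j) ≤ suc M
      j+[M∸j]≤L = ≤-trans (≤-reflexive (m+[n∸m]≡n j≤M)) (n≤1+n M)
    prefix≡0 : weight M a ≡ 0
    prefix≡0 = trans (sumBelow-const M below-false) (*-zeroʳ M)

  a[1+k′]≡false : a (suc k′) ≡ false
  a[1+k′]≡false with a (suc k′) in ak
  ... | false = refl
  ... | true  = contradiction (begin-strict
    m + m                           ≡⟨ N≡m+m ⟨
    2 + M                           ≡⟨ 1+k′+r≡N ⟨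
    suc k′ + r                      ≤⟨ +-monoʳ-≤ (suc k′) r≤m ⟩
    suc k′ + m                      <⟨ +-monoˡ-< m 1+k′<m ⟩
    m + m                           ∎) (<-irrefl refl)
    where
    r : ℕ
    r = (2 + M) ∸ suc k′
    1+k′+r≡N : suc k′ + r ≡ 2 + M
    1+k′+r≡N = m+[n∸m]≡n (≤-trans (<⇒≤ 1+k′<m) (≤-trans m≤L (n≤1+n _)))
    suffix-true : ∀ t → t < r → bit (a (suc k′ + t)) ≡ 1
    suffix-true t t<r = cong bit (monotone (suc k′) t (≤-pred (begin-strict
      suc k′ + t   <⟨ +-monoʳ-< (suc k′) t<r ⟩
      suc k′ + r   ≡⟨ 1+k′+r≡N ⟩
      2 + M        ∎)) ak)
    r≤m : r ≤ m
    r≤m = begin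
      r                                            ≡⟨ *-identityʳ r ⟨
      r * 1                                        ≡⟨ sumBelow-const r suffix-true ⟨
      sumBelow r (λ t → bit (a (suc k′ + t)))      ≤⟨ m≤n+m _ _ ⟩
      weight (suc k′) a + sumBelow r (λ t → bit (a (suc k′ + t))) ≡⟨ sumBelow-split (suc k′) r (bit ∘ a) ⟨
      weight (suc k′ + r) a                        ≡⟨ cong (λ n → weight n a) 1+k′+r≡N ⟩
      weight (2 + M) a                             ≡⟨ weight≡m ⟩
      m                                            ∎

  a[k′]≡false : a k′ ≡ false
  a[k′]≡false with a k′ in ak
  ... | false = refl
  ... | true  = contradiction
    (trans (sym a[1+k′]≡false) (trans (cong a (+-comm 1 k′)) (monotone k′ 1 k′+1≤L ak))) λ ()
    where
    k′+1≤L : k′ + 1 ≤ suc M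
    k′+1≤L = begin
      k′ + 1     ≡⟨ +-comm k′ 1 ⟩
      suc k′     ≤⟨ <⇒≤ 1+k′<m ⟩
      m          ≤⟨ m≤L ⟩
      suc M      ∎

  two-descents : 2 ≤ descents (2 + M) (2 + k′) a
  two-descents = begin
    2                                  ≡⟨ cong₂ _+_ (descent-at M k′ (wrap 0 M k′) aM≡true a[k′]≡false)
                                                    (descent-at (suc M) (suc k′) (wrap 1 M k′) aL≡true a[1+k′]≡false) ⟨
    D M + D (suc M)                    ≤⟨ +-monoˡ-≤ (D (suc M)) (m≤n+m (D M) (sumBelow M D)) ⟩
    sumBelow M D + D M + D (suc M)     ≡⟨ cong (_+ D (suc M)) (sumBelow-snoc M D) ⟨
    sumBelow (suc M) D + D (suc M)     ≡⟨ sumBelow-snoc (suc M) D ⟨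
    descents (2 + M) (2 + k′) a        ∎
    where
    D : ℕ → ℕ
    D j = bit (a j ∧ not (a (j + (2 + k′))))
    descent-at : ∀ i i′ → i + (2 + k′) ≡ i′ + (2 + M) → a i ≡ true → a i′ ≡ false → D i ≡ 1
    descent-at i i′ i+k≡i′+N ai ai′ =
      cong₂ (λ x y → bit (x ∧ not y)) ai (trans (cong a i+k≡i′+N) (trans (per i′) ai′))
    wrap : ∀ e x y → e + x + (2 + y) ≡ e + y + (2 + x)
    wrap = solve-∀

  four-changes : 4 ≤ changes (2 + M) (2 + k′) a
  four-changes = subst (4 ≤_) (sym (changes≡descents+descents (2 + M) (2 + k′) a per))
                   (+-mono-≤ two-descents two-descents)

-- Rotate a so that one of its two changes sits at the wrap-around, and complement it if it then starts with true.
block-changes : ∀ N m k (a : ℕ → Bool) → Periodic N a → N ≡ m + m → 2 ≤ k → k < m →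
                weight N a ≡ m → changes N 1 a ≡ 2 → 4 ≤ changes N k a
block-changes N m@(suc (suc (suc m″))) k@(suc (suc k′)) a per refl (s≤s (s≤s _)) k<m@(s≤s (s≤s (s≤s _)))
              weight≡m two-changes
  with sumBelow-positive N (λ j → bit (a j xor a (j + 1))) (subst (0 <_) (sym two-changes) z<s)
... | c , _ , change-at-c = normalise (a c) (a (c + 1)) refl refl change-at-c
  where
  M : ℕ
  M = suc (m″ + m)
  b : ℕ → Bool
  b j = a (j + suc c)
  b-periodic : Periodic N b
  b-periodic j = trans (cong a (+-rightComm j N (suc c))) (per (j + suc c))
  b-weight : weight N b ≡ m
  b-weight = trans (weight-rotate N a per (suc c)) weight≡m
  b-changes : ∀ s → changes N s b ≡ changes N s a
  b-changes s = changes-rotate N s a per (suc c)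
  b0≡a[c+1] : b 0 ≡ a (c + 1)
  b0≡a[c+1] = cong a (+-comm 1 c)
  bL≡a[c] : b (suc M) ≡ a c
  bL≡a[c] = trans (cong a (wrap (suc M) c)) (per c)
    where wrap : ∀ x y → x + suc y ≡ y + suc x
          wrap = solve-∀
  normalise : ∀ x y → a c ≡ x → a (c + 1) ≡ y → 0 < bit (x xor y) → 4 ≤ changes N k a
  normalise true false ac ac+1 _ = subst (4 ≤_) (b-changes k)
    (NormalisedBlock.four-changes M k′ m b b-periodic refl k<m b-weight
      (trans (b-changes 1) two-changes) (trans b0≡a[c+1] ac+1) (trans bL≡a[c] ac))
  normalise false true ac ac+1 _ = subst (4 ≤_) (trans (changes-not N k b) (b-changes k))
    (NormalisedBlock.four-changes M k′ m (not ∘ b) (cong not ∘ b-periodic) refl k<m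
      (+-cancelʳ-≡ m _ m (trans (cong (weight N (not ∘ b) +_) (sym b-weight)) (weight-not+weight N b)))
      (trans (changes-not N 1 b) (trans (b-changes 1) two-changes))
      (cong not (trans b0≡a[c+1] ac+1)) (cong not (trans bL≡a[c] ac)))
  normalise false false _ _ ()
  normalise true  true  _ _ ()

-- Counting odd edges of a pair of parity patterns

even-≢0⇒≥2 : ∀ {x} → 2 ∣ x → x ≢ 0 → 2 ≤ x
even-≢0⇒≥2 2∣x x≢0 = ∣⇒≤ {{≢-nonZero x≢0}} 2∣x

even-≢0⇒≡2⊎≥4 : ∀ {x} → 2 ∣ x → x ≢ 0 → x ≡ 2 ⊎ 4 ≤ x
even-≢0⇒≡2⊎≥4 (divides zero          x≡0) x≢0 = contradiction x≡0 x≢0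
even-≢0⇒≡2⊎≥4 (divides (suc zero)    x≡2) _   = inj₁ x≡2
even-≢0⇒≡2⊎≥4 (divides (suc (suc q)) x≡q) _   = inj₂ (subst (4 ≤_) (sym x≡q) (s≤s (s≤s (s≤s (s≤s z≤n)))))

single-sequence-lower-bound : ∀ N m k (a : ℕ → Bool) → Periodic N a → N ≡ m + m → 2 ≤ k → k < m →
  weight N a ≡ m → changes N 1 a ≢ 0 → changes N k a ≢ 0 → 6 ≤ changes N 1 a + changes N k a
single-sequence-lower-bound N m k a per N≡m+m 2≤k k<m weight≡m C₁≢0 Cₖ≢0
  with even-≢0⇒≡2⊎≥4 (changes-even N 1 a per) C₁≢0
... | inj₁ C₁≡2 = subst (λ x → 6 ≤ x + changes N k a) (sym C₁≡2)
                    (s≤s (s≤s (block-changes N m k a per N≡m+m 2≤k k<m weight≡m C₁≡2)))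
... | inj₂ C₁≥4 = +-mono-≤ C₁≥4 (even-≢0⇒≥2 (changes-even N k a per) Cₖ≢0)

rna-lower-bound : ∀ N .{{_ : NonZero N}} m k (p q : ℕ → Bool) → N ≡ m + m → 2 ≤ k → k < m → Identity 1 N k →
  Periodic N p → Periodic N q → weight N p + weight N q ≡ N →
  6 ≤ changes N 1 p + distance N p q + changes N k q
rna-lower-bound N m k p q N≡m+m 2≤k k<m bézout perᵖ perᵠ weights≡N =
  cases (C₁ ≟ 0) (Cₖ ≟ 0) (D ≟ 0)
  where
  C₁ D Cₖ : ℕ
  C₁ = changes N 1 p
  D  = distance N p q
  Cₖ = changes N k q
  6≤N : 6 ≤ N
  6≤N = subst (6 ≤_) (sym N≡m+m) (+-mono-≤ 3≤m 3≤m)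
    where
    3≤m : 3 ≤ m
    3≤m = ≤-trans (s≤s 2≤k) k<m
  D≡N⇒bound : D ≡ N → 6 ≤ C₁ + D + Cₖ
  D≡N⇒bound D≡N = ≤-trans 6≤N (subst (_≤ C₁ + D + Cₖ) D≡N (≤-trans (m≤n+m D C₁) (m≤m+n (C₁ + D) Cₖ)))
  cases : Dec (C₁ ≡ 0) → Dec (Cₖ ≡ 0) → Dec (D ≡ 0) → 6 ≤ C₁ + D + Cₖ
  cases (yes C₁≡0) _ _ = D≡N⇒bound (distance-const N p q (p 0) (λ j _ → p-const j) weights≡N)
    where
    p-const : ∀ j → p j ≡ p 0
    p-const = coprime-periods⇒constant N 1 p perᵖ (changes≡0⇒periodic N 1 p perᵖ C₁≡0) (-+ 0 1 refl)
  cases (no _) (yes Cₖ≡0) _ = D≡N⇒bound (trans (distance-comm N p q)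
    (distance-const N q p (q 0) (λ j _ → q-const j) (trans (+-comm (weight N q) (weight N p)) weights≡N)))
    where
    q-const : ∀ j → q j ≡ q 0
    q-const = coprime-periods⇒constant N k q perᵠ (changes≡0⇒periodic N k q perᵠ Cₖ≡0) bézout
  cases (no C₁≢0) (no Cₖ≢0) (no D≢0) =
    +-mono-≤ (+-mono-≤ (even-≢0⇒≥2 (changes-even N 1 p perᵖ) C₁≢0)
                       (even-≢0⇒≥2 (distance-even N m p q (trans weights≡N N≡m+m)) D≢0))
             (even-≢0⇒≥2 (changes-even N k q perᵠ) Cₖ≢0)
  cases (no C₁≢0) (no Cₖ≢0) (yes D≡0) = subst (6 ≤_) C₁+Cₖ[p]≡total
    (single-sequence-lower-bound N m k p perᵖ N≡m+m 2≤k k<m weightᵖ≡m C₁≢0 (Cₖ≢0 ∘ trans Cₖ≡Cₖ[p]))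
    where
    p≡q : ∀ j → p j ≡ q j
    p≡q = periodic-ext N p q perᵖ perᵠ (λ j j<N → bit-xor≡0 (sumBelow-≡0 N _ D≡0 j j<N))
    Cₖ≡Cₖ[p] : Cₖ ≡ changes N k p
    Cₖ≡Cₖ[p] = sumBelow-cong N (λ j _ → cong₂ (λ x y → bit (x xor y)) (sym (p≡q j)) (sym (p≡q (j + k))))
    weightᵖ≡m : weight N p ≡ m
    weightᵖ≡m = *-cancelʳ-≡ (weight N p) m 2 (begin
      weight N p * 2            ≡⟨ m+m≡m*2 (weight N p) ⟨
      weight N p + weight N p   ≡⟨ cong (weight N p +_) (sumBelow-cong N (λ j _ → cong bit (p≡q j))) ⟩
      weight N p + weight N q   ≡⟨ trans weights≡N N≡m+m ⟩
      m + m                     ≡⟨ m+m≡m*2 m ⟩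
      m * 2                     ∎)
      where open ≡-Reasoning
    C₁+Cₖ[p]≡total : C₁ + changes N k p ≡ C₁ + D + Cₖ
    C₁+Cₖ[p]≡total = cong₂ _+_ (trans (sym (+-identityʳ C₁)) (cong (C₁ +_) (sym D≡0))) (sym Cₖ≡Cₖ[p])

-- Parity patterns of a labeling of P(n,k)

length-filter-∷ : ∀ {A : Set} {P : Pred A 0ℓ} (P? : Decidable P) x xs →
                  length (filter P? (x ∷ xs)) ≡ bit (does (P? x)) + length (filter P? xs)
length-filter-∷ P? x xs with does (P? x)
... | true  = refl
... | false = refl

length-filter-three : ∀ {A : Set} {P : Pred A 0ℓ} (P? : Decidable P) x y z →
                      length (filter P? (x ∷ y ∷ z ∷ [])) ≡ bit (does (P? x)) + bit (does (P? y)) + bit (does (P? z))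
length-filter-three P? x y z = begin
  length (filter P? (x ∷ y ∷ z ∷ []))       ≡⟨ length-filter-∷ P? x _ ⟩
  X + length (filter P? (y ∷ z ∷ []))       ≡⟨ cong (X +_) (length-filter-∷ P? y _) ⟩
  X + (Y + length (filter P? (z ∷ [])))     ≡⟨ cong (λ w → X + (Y + w)) (length-filter-∷ P? z []) ⟩
  X + (Y + (Z + 0))                         ≡⟨ cong (λ w → X + (Y + w)) (+-identityʳ Z) ⟩
  X + (Y + Z)                               ≡⟨ +-assoc X Y Z ⟨
  X + Y + Z                                 ∎
  where
  open ≡-Reasoning
  X Y Z : ℕ
  X = bit (does (P? x))
  Y = bit (does (P? y))
  Z = bit (does (P? z))

length-filter-concat : ∀ {A : Set} {P : Pred A 0ℓ} (P? : Decidable P) n (g : Fin n → List A) →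
                       length (filter P? (concat (tabulate g))) ≡ sum (λ i → length (filter P? (g i)))
length-filter-concat P? zero    g = refl
length-filter-concat P? (suc n) g = begin
  length (filter P? (g zero ++ concat (tabulate (g ∘ suc))))
    ≡⟨ cong length (filter-++ P? (g zero) _) ⟩
  length (filter P? (g zero) ++ filter P? (concat (tabulate (g ∘ suc))))
    ≡⟨ length-++ (filter P? (g zero)) ⟩
  length (filter P? (g zero)) + length (filter P? (concat (tabulate (g ∘ suc))))
    ≡⟨ cong (length (filter P? (g zero)) +_) (length-filter-concat P? n (g ∘ suc)) ⟩
  sum (λ i → length (filter P? (g i))) ∎
  where open ≡-Reasoning

isOdd : ∀ {N} → Fin N → Bool
isOdd x = parity x ≡ᵇ 1

parity≡bit-isOdd : ∀ {N} (x : Fin N) → parity x ≡ bit (isOdd x)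
parity≡bit-isOdd x with parity x | m%n<n (toℕ x) 2
... | 0 | _ = refl
... | 1 | _ = refl
... | suc (suc _) | s≤s (s≤s ())

parity-differs : ∀ {N} (x y : Fin N) → does (¬? (parity x ≟ parity y)) ≡ isOdd x xor isOdd y
parity-differs x y with parity x | m%n<n (toℕ x) 2 | parity y | m%n<n (toℕ y) 2
... | 0 | _ | 0 | _ = refl
... | 0 | _ | 1 | _ = refl
... | 1 | _ | 0 | _ = refl
... | 1 | _ | 1 | _ = refl
... | suc (suc _) | s≤s (s≤s ()) | _ | _
... | _ | _ | suc (suc _) | s≤s (s≤s ())

module _ {n : ℕ} .{{_ : NonZero n}} where

  toFin : ℕ → Fin n
  toFin j = fromℕ< (m%n<n j n)

  toFin-toℕ : ∀ i → toFin (toℕ i) ≡ i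
  toFin-toℕ i = toℕ-injective (trans (toℕ-fromℕ< (m%n<n (toℕ i) n)) (m<n⇒m%n≡m (toℕ<n i)))

  toFin-periodic : Periodic n toFin
  toFin-periodic j = fromℕ<-cong _ _ ([m+n]%n≡m%n j n) (m%n<n (j + n) n) (m%n<n j n)

  oddAt : Labeling n → Bool → ℕ → Bool
  oddAt f b j = isOdd (Bijection.to f (b , toFin j))

  oddAt-periodic : ∀ f b → Periodic n (oddAt f b)
  oddAt-periodic f b j = cong (λ i → isOdd (Bijection.to f (b , i))) (toFin-periodic j)

  rnaCount≡sumBelow : ∀ k f → rnaCount n k f ≡
    sumBelow n (λ j → bit (oddAt f false j xor oddAt f false (j + 1)) + bit (oddAt f false j xor oddAt f true j)
                        + bit (oddAt f true j xor oddAt f true (j + k)))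
  rnaCount≡sumBelow k f = begin
    length (filter P? (concatMap edges (allFin n)))
      ≡⟨ cong (length ∘ filter P? ∘ concat) (map-tabulate id edges) ⟩
    length (filter P? (concat (tabulate edges)))
      ≡⟨ length-filter-concat P? n edges ⟩
    sum (λ i → length (filter P? (edges i)))
      ≡⟨ sum-cong-≗ odd-edges-at ⟩
    sum (λ i → odd-edges i (toFin (toℕ i))) ∎
    where
    open ≡-Reasoning
    F : PVertex n → Fin (2 * n)
    F = Bijection.to f
    P? : Decidable (λ (e : PVertex n × PVertex n) → ¬ parity (F (proj₁ e)) ≡ parity (F (proj₂ e)))
    P? e = ¬? (parity (F (proj₁ e)) ≟ parity (F (proj₂ e)))
    outer spoke inner : Fin n → PVertex n × PVertex n
    outer i = (false , i) , (false , (i +ₘ 1))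
    spoke i = (false , i) , (true , i)
    inner i = (true , i) , (true , (i +ₘ k))
    edges : Fin n → List (PVertex n × PVertex n)
    edges i = outer i ∷ spoke i ∷ inner i ∷ []
    odd : Bool → Fin n → Bool
    odd b i = isOdd (F (b , i))
    odd-edges : Fin n → Fin n → ℕ
    odd-edges i i′ = bit (odd false i′ xor odd false (i +ₘ 1)) + bit (odd false i′ xor odd true i′)
                     + bit (odd true i′ xor odd true (i +ₘ k))
    is-odd-edge : ∀ e → bit (does (P? e)) ≡ bit (isOdd (F (proj₁ e)) xor isOdd (F (proj₂ e)))
    is-odd-edge e = cong bit (parity-differs (F (proj₁ e)) (F (proj₂ e)))
    odd-edges-at : ∀ i → length (filter P? (edges i)) ≡ odd-edges i (toFin (toℕ i))
    odd-edges-at i = begin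
      length (filter P? (edges i))
        ≡⟨ length-filter-three P? (outer i) (spoke i) (inner i) ⟩
      bit (does (P? (outer i))) + bit (does (P? (spoke i))) + bit (does (P? (inner i)))
        ≡⟨ cong₂ _+_ (cong₂ _+_ (is-odd-edge (outer i)) (is-odd-edge (spoke i))) (is-odd-edge (inner i)) ⟩
      odd-edges i i
        ≡⟨ cong (odd-edges i) (toFin-toℕ i) ⟨
      odd-edges i (toFin (toℕ i)) ∎

  rnaCount-formula : ∀ k f → rnaCount n k f ≡
    changes n 1 (oddAt f false) + distance n (oddAt f false) (oddAt f true) + changes n k (oddAt f true)
  rnaCount-formula k f = begin
    rnaCount n k f                    ≡⟨ rnaCount≡sumBelow k f ⟩
    sumBelow n (λ j → C₁ j + D j + Cₖ j) ≡⟨ sumBelow-+ n (λ j → C₁ j + D j) Cₖ ⟩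
    sumBelow n (λ j → C₁ j + D j) + sumBelow n Cₖ ≡⟨ cong (_+ sumBelow n Cₖ) (sumBelow-+ n C₁ D) ⟩
    sumBelow n C₁ + sumBelow n D + sumBelow n Cₖ ∎
    where
    open ≡-Reasoning
    p q : ℕ → Bool
    p = oddAt f false
    q = oddAt f true
    C₁ D Cₖ : ℕ → ℕ
    C₁ j = bit (p j xor p (j + 1))
    D  j = bit (p j xor q j)
    Cₖ j = bit (q j xor q (j + k))

vertices↔ : ∀ n → Fin (n * 2) ↔ PVertex n
vertices↔ n = ×-comm (Fin n) Bool ↔-∘ (×-cong (↔-id (Fin n)) 2↔Bool ↔-∘ *↔×)

sum-over-vertices : ∀ n (h : PVertex n → ℕ) →
                    sum (h ∘ Inverse.to (vertices↔ n)) ≡ sum {n} (λ i → h (false , i) + h (true , i))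
sum-over-vertices zero    h = refl
sum-over-vertices (suc n) h =
  trans (cong (λ x → h (false , zero) + (h (true , zero) + x)) (sum-over-vertices n (λ (b , i) → h (b , suc i))))
        (sym (+-assoc (h (false , zero)) _ _))

sum-over-labels : ∀ {n} (f : Labeling n) (g : Fin (2 * n) → ℕ) →
                  sum g ≡ sum {n} (λ i → g (Bijection.to f (false , i)) + g (Bijection.to f (true , i)))
sum-over-labels {n} f g = trans (sum-permute g (⤖⇒↔ f ↔-∘ vertices↔ n)) (sum-over-vertices n (g ∘ Bijection.to f))

-- u_i gets label 2i+1 and v_i gets label 2i+2.
standardLabeling : ∀ n → Labeling n
standardLabeling n = ↔⇒⤖ (cast↔ ↔-∘ ↔-sym (vertices↔ n))
  where
  cast↔ : Fin (n * 2) ↔ Fin (2 * n)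
  cast↔ = mk↔ₛ′ (cast (*-comm n 2)) (cast (*-comm 2 n))
                (cast-involutive (*-comm n 2) (*-comm 2 n)) (cast-involutive (*-comm 2 n) (*-comm n 2))

parity-standardLabeling : ∀ n b i → parity (Bijection.to (standardLabeling n) (b , i)) ≡ bit b
parity-standardLabeling n b i = begin
  toℕ (cast (*-comm n 2) (combine i j)) % 2  ≡⟨ cong (_% 2) (toℕ-cast (*-comm n 2) (combine i j)) ⟩
  toℕ (combine i j) % 2                     ≡⟨ cong (_% 2) (toℕ-combine i j) ⟩
  (2 * toℕ i + toℕ j) % 2                   ≡⟨ %-remove-+ˡ (toℕ j) (m∣m*n (toℕ i)) ⟩
  toℕ j % 2                                 ≡⟨ label-parity b ⟩
  bit b                                     ∎
  where
  open ≡-Reasoning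
  j : Fin 2
  j = Inverse.from 2↔Bool b
  label-parity : ∀ b → toℕ (Inverse.from 2↔Bool b) % 2 ≡ bit b
  label-parity false = refl
  label-parity true  = refl

module _ {n : ℕ} .{{_ : NonZero n}} where

  weight-oddAt : ∀ f b → weight n (oddAt f b) ≡ sum {n} (λ i → parity (Bijection.to f (b , i)))
  weight-oddAt f b = sum-cong-≗ λ i →
    trans (cong (λ i′ → bit (isOdd (Bijection.to f (b , i′)))) (toFin-toℕ i)) (sym (parity≡bit-isOdd (Bijection.to f (b , i))))

  -- Every labeling uses the same n odd labels; the standard one shows that there are n of them.
  odd-labels : ∀ f → weight n (oddAt f false) + weight n (oddAt f true) ≡ n
  odd-labels f = begin
    weight n (oddAt f false) + weight n (oddAt f true)
      ≡⟨ cong₂ _+_ (weight-oddAt f false) (weight-oddAt f true) ⟩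
    sum (λ i → parity (F f (false , i))) + sum (λ i → parity (F f (true , i)))
      ≡⟨ ∑-distrib-+ {n} (λ i → parity (F f (false , i))) (λ i → parity (F f (true , i))) ⟨
    sum (λ i → parity (F f (false , i)) + parity (F f (true , i)))
      ≡⟨ sum-over-labels f parity ⟨
    sum (parity {2 * n})
      ≡⟨ sum-over-labels (standardLabeling n) parity ⟩
    sum (λ i → parity (F (standardLabeling n) (false , i)) + parity (F (standardLabeling n) (true , i)))
      ≡⟨ sum-cong-≗ (λ i → cong₂ _+_ (parity-standardLabeling n false i) (parity-standardLabeling n true i)) ⟩
    sumBelow n (λ _ → 1)
      ≡⟨ sumBelow-const n (λ _ _ → refl) ⟩
    n * 1
      ≡⟨ *-identityʳ n ⟩
    n ∎
    where
    open ≡-Reasoning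
    F : Labeling n → PVertex n → Fin (2 * n)
    F = Bijection.to

  standardLabeling-rnaCount : ∀ k → rnaCount n k (standardLabeling n) ≡ n
  standardLabeling-rnaCount k =
    trans (rnaCount≡sumBelow k L) (trans (sumBelow-const n (λ j _ → only-spokes-odd j)) (*-identityʳ n))
    where
    L : Labeling n
    L = standardLabeling n
    oddAt-L : ∀ b j → oddAt L b j ≡ b
    oddAt-L b j = trans (cong (_≡ᵇ 1) (parity-standardLabeling n b (toFin j))) (bit≡ᵇ1 b)
      where
      bit≡ᵇ1 : ∀ b → (bit b ≡ᵇ 1) ≡ b
      bit≡ᵇ1 false = refl
      bit≡ᵇ1 true  = refl
    only-spokes-odd : ∀ j → bit (oddAt L false j xor oddAt L false (j + 1)) + bit (oddAt L false j xor oddAt L true j)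
                            + bit (oddAt L true j xor oddAt L true (j + k)) ≡ 1
    only-spokes-odd j rewrite oddAt-L false j | oddAt-L false (j + 1) | oddAt-L true j | oddAt-L true (j + k) = refl

theorem4p5 : (n k : ℕ) → 8 ≤ n → 2 ∣ n → 3 ≤ k → 2 * k < n → gcd n k ≡ 1
    → (nz : NonZero n) → σ⁻≥ n k {{nz}} 6 × σ⁻≤ n k {{nz}} n
-- The hypothesis 8 ≤ n is implied by the others and 3 ≤ k is only used as 2 ≤ k.
theorem4p5 n k _ (divides m n≡m*2) 3≤k 2k<n gcd≡1 nz = lower , upper
  where
  instance
    _ : NonZero n
    _ = nz
  n≡m+m : n ≡ m + m
  n≡m+m = trans n≡m*2 (sym (m+m≡m*2 m))
  k<m : k < m
  k<m = *-cancelʳ-< 2 k m (subst (_< m * 2) (*-comm 2 k) (subst (2 * k <_) n≡m*2 2k<n))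
  bézout : Identity 1 n k
  bézout = Bézout.identity (subst (GCD n k) gcd≡1 (gcd-GCD n k))
  lower : σ⁻≥ n k 6
  lower f = subst (6 ≤_) (sym (rnaCount-formula k f))
    (rna-lower-bound n m k (oddAt f false) (oddAt f true) n≡m+m (≤-trans (n≤1+n 2) 3≤k) k<m bézout
      (oddAt-periodic f false) (oddAt-periodic f true) (odd-labels f))
  upper : σ⁻≤ n k n
  upper = standardLabeling n , ≤-reflexive (standardLabeling-rnaCount k)
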